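{- Let $\mathcal U$ be a collection of disjoint non-empty subsets of $V(G)$ for a graph $G$, and let $\mathcal P$ be a $\mathcal U$-anchored path system in $G$ consisting of $t$ paths such that $R_{\mathcal U}(\mathcal P)$ has an Euler tour. Then there exists a $\mathcal U$-anchored path system $\mathcal P'$ in $G$ such that $R_{\mathcal U}(\mathcal P')$ has an Euler tour and $|V(\mathcal P')\cap U|\le 2t$ for every $U\in\mathcal U$.
   Context: All graphs are finite and simple. A path system is a collection of vertex-disjoint paths; $V(\mathcal P)$ denotes the union of the vertex sets of its paths. A path system $\mathcal P$ is $\mathcal U$-anchored if every endpoint of every path in $\mathcal P$ lies in $\bigcup_{U\in\mathcal U}U$. For a $\mathcal U$-anchored path system $\mathcal P$, the reduced multigraph $R_{\mathcal U}(\mathcal P)$ has vertex set $\mathcal U$ and, for each path of $\mathcal P$ with one endpoint in $U$ and the other in $U'$, a distinct edge between $U$ and $U'$ (a loop if $U=U'$). An Euler tour in a multigraph is a closed walk that visits every vertex and uses each edge exactly once. -}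

module Defs where

open import Data.Nat using (ℕ)
open import Data.Fin using (Fin)
open import Data.Fin.Subset as S using (Subset; Nonempty; Empty; _∩_)
open import Data.Fin.Subset.Properties using (_∈?_)
open import Data.List using (List; []; _∷_; length; filter; map; concat; lookup; allFin)
open import Data.List.NonEmpty as L⁺ using (List⁺; toList)
open import Data.List.Relation.Unary.Linked using (Linked)
open import Data.List.Relation.Unary.Unique.Propositional using (Unique)
open import Data.List.Relation.Unary.AllPairs using (AllPairs)
open import Data.List.Relation.Unary.All using (All)
open import Data.List.Relation.Binary.Pointwise using (Pointwise)
open import Data.List.Relation.Binary.Disjoint.Propositional using (Disjoint)
open import Data.List.Relation.Binary.Permutation.Propositional using (_↭_)
import Data.List.Membership.Propositional as LM
open import Data.Product using (Σ; ∃; ∃-syntax; _×_; _,_)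
open import Data.Sum using (_⊎_)
open import Relation.Nullary using (¬_)
open import Relation.Binary.PropositionalEquality using (_≡_; _≢_)

record Graph (n : ℕ) : Set₁ where
  field
    Adj     : Fin n → Fin n → Set
    sym     : ∀ {x y} → Adj x y → Adj y x
    irrefl  : ∀ {x} → ¬ Adj x x
open Graph public

IsPath : ∀ {n} → Graph n → List⁺ (Fin n) → Set
IsPath G p = Linked (Adj G) (toList p) × Unique (toList p)

PathSystem : ℕ → Set
PathSystem n = List (List⁺ (Fin n))

IsPathSystem : ∀ {n} → Graph n → PathSystem n → Set
IsPathSystem G 𝒫 = All (IsPath G) 𝒫 × AllPairs (λ p q → Disjoint (toList p) (toList q)) 𝒫

-- V(𝒫) as a list (duplicate-free for a path system).
V : ∀ {n} → PathSystem n → List (Fin n)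
V 𝒫 = concat (map toList 𝒫)

IsCollection : ∀ {n k} → (Fin k → Subset n) → Set
IsCollection {k = k} 𝒰 = (∀ i → Nonempty (𝒰 i)) × (∀ i j → i ≢ j → Empty (𝒰 i ∩ 𝒰 j))

Anchored : ∀ {n k} → (Fin k → Subset n) → PathSystem n → Set
Anchored 𝒰 𝒫 = All (λ p → (∃[ i ] L⁺.head p S.∈ 𝒰 i) × (∃[ j ] L⁺.last p S.∈ 𝒰 j)) 𝒫

-- A multigraph on Fin k given by its list of edges (loops allowed);
-- edge e of E joins the two entries of the pair (lookup E e).
Multigraph : ℕ → Set
Multigraph k = List (Fin k × Fin k)

-- R_𝒰(𝒫) ≡ E : the e-th edge of E corresponds to the e-th path of 𝒫,
-- joining the classes containing its two endpoints. (Since the classes are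
-- disjoint, E is determined by 𝒫 up to orienting the edges.)
IsReduced : ∀ {n k} → (Fin k → Subset n) → PathSystem n → Multigraph k → Set
IsReduced 𝒰 𝒫 E =
  Pointwise (λ p (i , j) → (L⁺.head p S.∈ 𝒰 i) × (L⁺.last p S.∈ 𝒰 j)) 𝒫 E

Joins : ∀ {k} (E : Multigraph k) → Fin (length E) → Fin k → Fin k → Set
Joins E e u w = (lookup E e ≡ (u , w)) ⊎ (lookup E e ≡ (w , u))

data Walk {k} (E : Multigraph k) : Fin k → Fin k → List (Fin k) → List (Fin (length E)) → Set where
  stop : ∀ {v} → Walk E v v (v ∷ []) []
  step : ∀ {u w z vs es} (e : Fin (length E)) → Joins E e u w →
         Walk E w z vs es → Walk E u z (u ∷ vs) (e ∷ es)

EulerTour : ∀ {k} → Multigraph k → Set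
EulerTour {k} E =
  Σ (Fin k) λ v → Σ (List (Fin k)) λ vs → Σ (List (Fin (length E))) λ es →
    Walk E v v vs es × (es ↭ allFin (length E)) × (∀ x → x LM.∈ vs)

ReducedHasEulerTour : ∀ {n k} → (Fin k → Subset n) → PathSystem n → Set
ReducedHasEulerTour {k = k} 𝒰 𝒫 = Σ (Multigraph k) λ E → IsReduced 𝒰 𝒫 E × EulerTour E

countIn : ∀ {n} → Subset n → PathSystem n → ℕ
countIn U 𝒫 = length (filter (_∈? U) (V 𝒫))

-- Each path of 𝒫, running between classes U and U′ of 𝒰, is cut down to a sequence of
-- disjoint subpaths forming a walk from U to U′ in the reduced multigraph: start at the
-- last vertex of the path in U, follow the path up to the first vertex whose class U″
-- occurs again further on, and continue from the last vertex of the path in U″. A class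
-- then meets the kept vertices of one path at most twice, at the end of one subpath and
-- the start of the next. Replacing each edge of the Euler tour of R_𝒰(𝒫) by the walk of
-- its path, reversed where the tour traverses the edge backwards, gives an Euler tour of
-- R_𝒰(𝒫′) for the path system 𝒫′ of all these subpaths.
module Submission where

open import Defs hiding (sym)
open import Function using (_∘_; id)
open import Data.Nat using (ℕ; zero; suc; _≤_; _+_; _*_; z≤n; s≤s)
open import Data.Nat.Properties
  using (≤-reflexive; ≤-trans; n≤0⇒n≡0; m≤n⇒m≤1+n; +-mono-≤; +-identityʳ; +-comm; *-comm; module ≤-Reasoning)
open import Data.Fin using (Fin; zero; suc; _≟_)
import Data.Fin.Properties as Fin
open import Data.Fin.Subset as Subset using (Subset)
open import Data.Fin.Subset.Properties using (_∈?_; x∈p∩q⁺)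
open import Data.List
  using (List; []; _∷_; _++_; _∷ʳ_; [_]; length; map; concat; lookup; allFin; tabulate; filter; initLast; _∷ʳ′_)
open import Data.List.Properties
  using (++-assoc; ++-identityʳ; length-++; map-++; concat-++; map-tabulate;
         length-filter; filter-++; filter-accept; filter-reject; filter-none)
open import Data.List.NonEmpty as List⁺ using (List⁺; _∷_; toList; _⁺++_; _⁺∷ʳ_)
open import Data.List.Relation.Unary.Linked as Linked using (Linked; []; [-]; _∷_)
open import Data.List.Relation.Unary.All as All using (All; []; _∷_)
import Data.List.Relation.Unary.All.Properties as All
open import Data.List.Relation.Unary.AllPairs as AllPairs using (AllPairs; []; _∷_)
import Data.List.Relation.Unary.AllPairs.Properties as AllPairs
open import Data.List.Relation.Unary.Any using (Any; here; there; any?)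
open import Data.List.Relation.Unary.Unique.Propositional using (Unique)
import Data.List.Relation.Unary.Unique.Propositional.Properties as Unique
open import Data.List.Relation.Binary.Disjoint.Propositional using (Disjoint)
open import Data.List.Relation.Binary.Pointwise using (Pointwise; []; _∷_; Pointwise-length)
open import Data.List.Relation.Binary.Sublist.Propositional as ⊑ using () renaming (_⊆_ to _⊑_)
import Data.List.Relation.Binary.Sublist.Propositional.Properties as Sublist
open import Data.List.Relation.Binary.Subset.Propositional using (_⊆_)
open import Data.List.Relation.Binary.Permutation.Propositional as ↭
  using (_↭_; ↭-refl; ↭-sym; ↭-trans; ↭⇒↭ₛ)
open import Data.List.Relation.Binary.Permutation.Propositional.Properties as ↭
  using (All-resp-↭; ++⁺; ++⁺ˡ; shifts; ∷↭∷ʳ; filter-↭; ↭-length)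
import Data.List.Relation.Binary.Permutation.Setoid.Properties as ↭ₛ
open import Data.List.Membership.Propositional using (_∈_)
open import Data.List.Membership.Propositional.Properties using (∈-concat⁺′)
open import Data.Product using (Σ; ∃; ∃₂; _×_; _,_; proj₁; proj₂)
open import Data.Sum using (_⊎_; inj₁; inj₂)
open import Data.Empty using (⊥-elim)
open import Relation.Nullary using (¬_; Dec; yes; no; contradiction)
open import Relation.Unary using (Decidable)
open import Relation.Binary.PropositionalEquality
  using (_≡_; _≢_; refl; sym; trans; cong; subst; subst₂; setoid; module ≡-Reasoning)

module _ {A : Set} where

  AllPairs-++⁻ : ∀ {R : A → A → Set} xs {ys} → AllPairs R (xs ++ ys) →
    AllPairs R xs × AllPairs R ys × All (λ x → All (R x) ys) xs
  AllPairs-++⁻ [] rs = [] , rs , []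
  AllPairs-++⁻ (x ∷ xs) (rx ∷ rs) with AllPairs-++⁻ xs rs
  ... | rxs , rys , rxsys = All.++⁻ˡ xs rx ∷ rxs , rys , All.++⁻ʳ xs rx ∷ rxsys

  Unique-concat⁻ : ∀ {xss : List (List A)} → Unique (concat xss) → All Unique xss × AllPairs Disjoint xss
  Unique-concat⁻ {[]} _ = [] , []
  Unique-concat⁻ {xs ∷ xss} u with AllPairs-++⁻ xs u
  ... | uxs , urest , apart with Unique-concat⁻ urest
  ...   | uxss , dxss = uxs ∷ uxss , All.tabulate disjoint ∷ dxss
    where
    disjoint : ∀ {ys} → ys ∈ xss → Disjoint xs ys
    disjoint ys∈xss (v∈xs , v∈ys) = All.lookup (All.lookup apart v∈xs) (∈-concat⁺′ v∈ys ys∈xss) refl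

  Unique-resp-⊑ : ∀ {xs ys : List A} → xs ⊑ ys → Unique ys → Unique xs
  Unique-resp-⊑ ⊑.[] [] = []
  Unique-resp-⊑ (y ⊑.∷ʳ xs⊑ys) (_ ∷ u) = Unique-resp-⊑ xs⊑ys u
  Unique-resp-⊑ (refl ⊑.∷ xs⊑ys) (x∉ys ∷ u) = Sublist.All-resp-⊆ xs⊑ys x∉ys ∷ Unique-resp-⊑ xs⊑ys u

  Any-head : ∀ {P : A → Set} {x xs} → Any P (x ∷ xs) → ¬ Any P xs → P x
  Any-head (here px) _ = px
  Any-head (there pxs) ¬pxs = contradiction pxs ¬pxs

  Unique-resp-↭ : ∀ {xs ys : List A} → xs ↭ ys → Unique xs → Unique ys
  Unique-resp-↭ p = ↭ₛ.Unique-resp-↭ (setoid A) (↭⇒↭ₛ p)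

  module _ {R : A → A → Set} where

    Linked-++⁻ˡ : ∀ xs {ys} → Linked R (xs ++ ys) → Linked R xs
    Linked-++⁻ˡ [] _ = []
    Linked-++⁻ˡ (x ∷ []) _ = [-]
    Linked-++⁻ˡ (x ∷ y ∷ xs) (r ∷ rs) = r ∷ Linked-++⁻ˡ (y ∷ xs) rs

    Linked-++⁻ʳ : ∀ xs {ys} → Linked R (xs ++ ys) → Linked R ys
    Linked-++⁻ʳ [] rs = rs
    Linked-++⁻ʳ (x ∷ xs) rs = Linked-++⁻ʳ xs (Linked.tail rs)

concat-map-↭ : ∀ {A B : Set} (f : A → List B) {xs ys} → xs ↭ ys → concat (map f xs) ↭ concat (map f ys)
concat-map-↭ f ↭.refl = ↭-refl
concat-map-↭ f (↭.prep x p) = ++⁺ˡ (f x) (concat-map-↭ f p)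
concat-map-↭ f (↭.swap x y p) = ↭-trans (shifts (f x) (f y)) (++⁺ˡ (f y) (++⁺ˡ (f x) (concat-map-↭ f p)))
concat-map-↭ f (↭.trans p q) = ↭-trans (concat-map-↭ f p) (concat-map-↭ f q)

vertices : ∀ {A : Set} → List (List⁺ A) → List A
vertices ss = concat (map toList ss)

data Segments {A : Set} : List A → List (List⁺ A) → Set where
  []   : Segments [] []
  skip : ∀ {x xs ss} → Segments xs ss → Segments (x ∷ xs) ss
  cut  : ∀ s {xs ss} → Segments xs ss → Segments (toList s ++ xs) (s ∷ ss)

module _ {A : Set} where

  Segments-++ : ∀ {xs ys : List A} {ss ts} → Segments xs ss → Segments ys ts → Segments (xs ++ ys) (ss ++ ts)
  Segments-++ [] t = t
  Segments-++ (skip s) t = skip (Segments-++ s t)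
  Segments-++ {ys = ys} {ts = ts} (cut s {xs} {ss} σ) t =
    subst (λ zs → Segments zs (s ∷ ss ++ ts)) (sym (++-assoc (toList s) xs ys)) (cut s (Segments-++ σ t))

  Segments⇒⊑ : ∀ {xs : List A} {ss} → Segments xs ss → vertices ss ⊑ xs
  Segments⇒⊑ [] = ⊑.[]
  Segments⇒⊑ (skip {x} s) = x ⊑.∷ʳ Segments⇒⊑ s
  Segments⇒⊑ (cut s σ) = Sublist.++⁺ ⊑.⊆-refl (Segments⇒⊑ σ)

  Segments-linked : ∀ {R : A → A → Set} {xs ss} → Segments xs ss → Linked R xs → All (Linked R ∘ toList) ss
  Segments-linked [] _ = []
  Segments-linked (skip s) r = Segments-linked s (Linked.tail r)
  Segments-linked (cut s σ) r = Linked-++⁻ˡ (toList s) r ∷ Segments-linked σ (Linked-++⁻ʳ (toList s) r)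

module _ {A : Set} where

  last-∷ : ∀ (x y : A) ys → List⁺.last (x ∷ y ∷ ys) ≡ List⁺.last (y ∷ ys)
  last-∷ x y ys with initLast ys
  ... | [] = refl
  ... | zs ∷ʳ′ z = refl

  last-++ : ∀ x xs y (ys : List A) → List⁺.last (x ∷ xs ++ y ∷ ys) ≡ List⁺.last (y ∷ ys)
  last-++ x [] y ys = last-∷ x y ys
  last-++ x (x′ ∷ xs) y ys = trans (last-∷ x x′ (xs ++ y ∷ ys)) (last-++ x′ xs y ys)

  last-⁺∷ʳ : ∀ (P : List⁺ A) b → List⁺.last (P ⁺∷ʳ b) ≡ b
  last-⁺∷ʳ (x ∷ xs) b = last-++ x xs b []

  ⁺∷ʳ-⁺++ : ∀ (P : List⁺ A) b B → (P ⁺∷ʳ b) ⁺++ B ≡ P ⁺++ (b ∷ B)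
  ⁺∷ʳ-⁺++ (x ∷ xs) b B = cong (x ∷_) (++-assoc xs [ b ] B)

  ⁺++-identityʳ : ∀ (P : List⁺ A) → P ⁺++ [] ≡ P
  ⁺++-identityʳ (x ∷ xs) = cong (x ∷_) (++-identityʳ xs)

Connects : ∀ {C : Set} → C × C → C → C → Set
Connects e u w = e ≡ (u , w) ⊎ e ≡ (w , u)

module _ {X C : Set} (ends : X → C × C) where

  data Trail : C → C → List C → List X → Set where
    []  : ∀ {c} → Trail c c (c ∷ []) []
    _∷_ : ∀ {c d e vs x xs} → Connects (ends x) c d → Trail d e vs xs → Trail c e (c ∷ vs) (x ∷ xs)

  Route : C → C → List X → Set
  Route c d xs = ∃ λ vs → Trail c d vs xs

Connects-sym : ∀ {C : Set} {e : C × C} {u w} → Connects e u w → Connects e w u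
Connects-sym (inj₁ eq) = inj₂ eq
Connects-sym (inj₂ eq) = inj₁ eq

module _ {X C : Set} {ends : X → C × C} where

  Trail-start : ∀ {c d vs xs} → Trail ends c d vs xs → c ∈ vs
  Trail-start [] = here refl
  Trail-start (_ ∷ _) = here refl

  Trail-++ : ∀ {c d e vs ws xs ys} → Trail ends c d vs xs → Trail ends d e ws ys →
    ∃ λ us → Trail ends c e us (xs ++ ys) × ws ⊆ us
  Trail-++ [] t = _ , t , λ w∈ws → w∈ws
  Trail-++ (j ∷ s) t with Trail-++ s t
  ... | us , st , ws⊆us = _ , j ∷ st , there ∘ ws⊆us

  Route-reverse : ∀ {c d xs} → Route ends c d xs → ∃ λ xs′ → Route ends d c xs′ × xs′ ↭ xs
  Route-reverse (_ , []) = [] , (_ , []) , ↭-refl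
  Route-reverse (_ , _∷_ {x = x} j t) with Route-reverse (_ , t)
  ... | xs′ , (_ , t′) , p with Trail-++ t′ (Connects-sym j ∷ [])
  ...   | _ , t″ , _ = xs′ ∷ʳ x , (_ , t″) , ↭-trans (↭-sym (∷↭∷ʳ x xs′)) (↭.prep x p)

module _ {I X C : Set} {edge : I → C × C} {ends : X → C × C} (arcs : I → List X)
         (route : ∀ i → Route ends (proj₁ (edge i)) (proj₂ (edge i)) (arcs i)) where

  orient : ∀ {i u w} → Connects (edge i) u w → ∃ λ xs → Route ends u w xs × xs ↭ arcs i
  orient {i} (inj₁ eq) =
    arcs i , subst₂ (λ c d → Route ends c d (arcs i)) (cong proj₁ eq) (cong proj₂ eq) (route i) , ↭-refl
  orient {i} (inj₂ eq) =
    Route-reverse (subst₂ (λ c d → Route ends c d (arcs i)) (cong proj₁ eq) (cong proj₂ eq) (route i))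

  Trail-substitute : ∀ {u z vs is} → Trail edge u z vs is →
    ∃₂ λ ws xs → Trail ends u z ws xs × vs ⊆ ws × xs ↭ concat (map arcs is)
  Trail-substitute [] = _ , [] , [] , (λ v∈vs → v∈vs) , ↭-refl
  Trail-substitute (j ∷ t) with Trail-substitute t | orient j
  ... | ws , xs , t′ , vs⊆ws , p | ys , (_ , r) , q with Trail-++ r t′
  ...   | us , rt , ws⊆us = us , ys ++ xs , rt , covers , ++⁺ q p
    where
    covers : _ ⊆ us
    covers (here refl) = Trail-start rt
    covers (there v∈vs) = ws⊆us (vs⊆ws v∈vs)

module _ {k : ℕ} where

  Walk⇒Trail : ∀ {E : Multigraph k} {u z vs es} → Walk E u z vs es → Trail (lookup E) u z vs es
  Walk⇒Trail stop = []
  Walk⇒Trail (step e j w) = j ∷ Walk⇒Trail w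

  Walk-∷ : ∀ {E : Multigraph k} {e u z vs es} → Walk E u z vs es → Walk (e ∷ E) u z vs (map suc es)
  Walk-∷ stop = stop
  Walk-∷ (step e j w) = step (suc e) j (Walk-∷ w)

  Trail⇒Walk : ∀ {X : Set} {ends : X → Fin k × Fin k} {u z vs xs} → Trail ends u z vs xs →
    Walk (map ends xs) u z vs (allFin (length (map ends xs)))
  Trail⇒Walk [] = stop
  Trail⇒Walk {xs = x ∷ xs} (j ∷ t) =
    step zero j (subst (Walk _ _ _ _) (map-tabulate (λ e → e) suc) (Walk-∷ (Trail⇒Walk t)))

module _ {A B : Set} {R : A → B → Set} where

  Pointwise-index : ∀ {xs ys} → Pointwise R xs ys → Fin (length ys) → A
  Pointwise-index {x ∷ xs} (_ ∷ _) zero = x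
  Pointwise-index (_ ∷ rs) (suc e) = Pointwise-index rs e

  Pointwise-index-R : ∀ {xs ys} (rs : Pointwise R xs ys) e → R (Pointwise-index rs e) (lookup ys e)
  Pointwise-index-R (r ∷ _) zero = r
  Pointwise-index-R (_ ∷ rs) (suc e) = Pointwise-index-R rs e

  tabulate-Pointwise-index : ∀ {xs ys} (rs : Pointwise R xs ys) → tabulate (Pointwise-index rs) ≡ xs
  tabulate-Pointwise-index [] = refl
  tabulate-Pointwise-index {x ∷ xs} (_ ∷ rs) = cong (x ∷_) (tabulate-Pointwise-index rs)

module Shortcutting {A C : Set} (In : C → A → Set) (In? : ∀ c → Decidable (In c))
  (class? : ∀ a → Dec (∃ λ c → In c a)) (In-functional : ∀ {c d a} → In c a → In d a → c ≡ d) where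

  count : C → List A → ℕ
  count c xs = length (filter (In? c) xs)

  count-++ : ∀ u xs ys → count u (xs ++ ys) ≡ count u xs + count u ys
  count-++ u xs ys = trans (cong length (filter-++ (In? u) xs ys)) (length-++ (filter (In? u) xs))

  count-∷-∈ : ∀ {u x} xs → In u x → count u (x ∷ xs) ≡ suc (count u xs)
  count-∷-∈ xs ux = cong length (filter-accept (In? _) ux)

  count-∷-∉ : ∀ {u x} xs → ¬ In u x → count u (x ∷ xs) ≡ count u xs
  count-∷-∉ xs ¬ux = cong length (filter-reject (In? _) ¬ux)

  count-∷ʳ-∈ : ∀ {u b} xs → In u b → count u (xs ∷ʳ b) ≡ suc (count u xs)
  count-∷ʳ-∈ {u} {b} xs ub =
    trans (count-++ u xs [ b ]) (trans (cong (count u xs +_) (count-∷-∈ [] ub)) (+-comm (count u xs) 1))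

  count-∷ʳ-∉ : ∀ {u b} xs → ¬ In u b → count u (xs ∷ʳ b) ≡ count u xs
  count-∷ʳ-∉ {u} {b} xs ¬ub =
    trans (count-++ u xs [ b ]) (trans (cong (count u xs +_) (count-∷-∉ [] ¬ub)) (+-identityʳ (count u xs)))

  count-[-] : ∀ u x → count u [ x ] ≤ 1
  count-[-] u x = length-filter (In? u) [ x ]

  count-none : ∀ {u xs} → ¬ Any (In u) xs → count u xs ≡ 0
  count-none ¬any = cong length (filter-none (In? _) (All.¬Any⇒All¬ _ ¬any))

  count-mono : ∀ u {xs ys} → xs ⊑ ys → count u xs ≤ count u ys
  count-mono u xs⊑ys = Sublist.length-mono-≤ (Sublist.filter⁺ (In? u) (In? u) (λ { refl p → p }) xs⊑ys)

  record Arc : Set where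
    constructor arc
    field
      segment : List⁺ A
      {from to} : C
      head-in : In from (List⁺.head segment)
      last-in : In to (List⁺.last segment)

  classes : Arc → C × C
  classes a = Arc.from a , Arc.to a

  visited : List Arc → List A
  visited X = vertices (map Arc.segment X)

  Sparse : List A → Set
  Sparse W = ∀ u → count u W ≤ 2

  record Shortcut (c d : C) (xs : List A) : Set where
    field
      arcs     : List Arc
      segments : Segments xs (map Arc.segment arcs)
      route    : Route classes c d arcs
      sparse   : Sparse (visited arcs)

  -- The invariant of the current subpath P, with B the rest of the path.
  Fresh : List A → List A → Set
  Fresh P B = ∀ u → count u P ≤ 1 × (Any (In u) B → count u P ≡ 0)

  NotRevisited : List A → List A → Set
  NotRevisited P W = ∀ u → count u P ≡ 1 → count u W ≤ 1

  Repeats : A → List A → Set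
  Repeats b B = ∃ λ e → In e b × Any (In e) B

  repeats? : ∀ b B → Dec (Repeats b B)
  repeats? b B with class? b
  ... | no ¬cb = no λ (e , eb , _) → ¬cb (e , eb)
  ... | yes (e , eb) with any? (In? e) B
  ...   | yes eB = yes (e , eb , eB)
  ...   | no ¬eB = no λ (e′ , e′b , e′B) → ¬eB (subst (λ c → Any (In c) B) (In-functional e′b eb) e′B)

  fresh-[-] : ∀ {e x xs} → In e x → ¬ Any (In e) xs → Fresh [ x ] xs
  fresh-[-] {x = x} {xs} ex ¬exs u = count-[-] u x , λ uxs →
    count-∷-∉ [] λ ux → ¬exs (subst (λ c → Any (In c) xs) (In-functional ux ex) uxs)

  fresh-∷ʳ : ∀ {P b B} → Fresh P (b ∷ B) → ¬ Repeats b B → Fresh (P ∷ʳ b) B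
  fresh-∷ʳ {P} {b} fresh ¬rep u with In? u b
  ... | yes ub = ≤-reflexive (trans (count-∷ʳ-∈ P ub) (cong suc (proj₂ (fresh u) (here ub)))) ,
                 λ uB → ⊥-elim (¬rep (u , ub , uB))
  ... | no ¬ub = subst (_≤ 1) (sym (count-∷ʳ-∉ P ¬ub)) (proj₁ (fresh u)) ,
                 λ uB → trans (count-∷ʳ-∉ P ¬ub) (proj₂ (fresh u) (there uB))

  fresh-∷ʳ-once : ∀ {P b B u} → Fresh P (b ∷ B) → count u P ≡ 1 → count u (P ∷ʳ b) ≡ 1
  fresh-∷ʳ-once {P} {b} {u = u} fresh once with In? u b
  ... | yes ub = contradiction (trans (sym once) (proj₂ (fresh u) (here ub))) λ ()
  ... | no ¬ub = trans (count-∷ʳ-∉ P ¬ub) once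

  closing-sparse : ∀ {P b B W e} → Fresh P (b ∷ B) → In e b → W ⊑ B → count e W ≤ 1 → Sparse W →
    Sparse (P ∷ʳ b ++ W) × NotRevisited P (P ∷ʳ b ++ W)
  closing-sparse {P} {b} {B} {W} fresh eb W⊑B thin sparse = (proj₁ ∘ bounds) , (proj₂ ∘ bounds)
    where
    open ≤-Reasoning
    bounds : ∀ u → count u (P ∷ʳ b ++ W) ≤ 2 × (count u P ≡ 1 → count u (P ∷ʳ b ++ W) ≤ 1)
    bounds u with In? u b
    ... | yes ub with refl ← In-functional ub eb = bound , λ once → contradiction (trans (sym once) P≡0) λ ()
      where
      P≡0 = proj₂ (fresh u) (here ub)
      bound = begin
        count u (P ∷ʳ b ++ W)        ≡⟨ count-++ u (P ∷ʳ b) W ⟩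
        count u (P ∷ʳ b) + count u W ≡⟨ cong (_+ count u W) (trans (count-∷ʳ-∈ P ub) (cong suc P≡0)) ⟩
        suc (count u W)              ≤⟨ s≤s thin ⟩
        2                            ∎
    ... | no ¬ub rewrite count-++ u (P ∷ʳ b) W | count-∷ʳ-∉ P ¬ub with any? (In? u) B
    ...   | yes uB rewrite proj₂ (fresh u) (there uB) = sparse u , λ ()
    ...   | no ¬uB rewrite n≤0⇒n≡0 (≤-trans (count-mono u W⊑B) (≤-reflexive (count-none ¬uB)))
                          | +-identityʳ (count u P) = m≤n⇒m≤1+n (proj₁ (fresh u)) , λ _ → proj₁ (fresh u)

  open Shortcut

  mutual
    shortcut-from : ∀ {c d} (P : List⁺ A) B → In c (List⁺.head P) → Fresh (toList P) B →
      In d (List⁺.last (P ⁺++ B)) →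
      Σ (Shortcut c d (toList (P ⁺++ B))) (NotRevisited (toList P) ∘ visited ∘ arcs)
    shortcut-from P [] cP fresh dP = record
        { arcs     = [ arc P cP (subst (In _ ∘ List⁺.last) (⁺++-identityʳ P) dP) ]
        ; segments = cut P []
        ; route    = _ , inj₁ refl ∷ []
        ; sparse   = m≤n⇒m≤1+n ∘ once
        } , λ u _ → once u
      where
      once : ∀ u → count u (toList P ++ []) ≤ 1
      once u = subst (λ W → count u W ≤ 1) (sym (++-identityʳ (toList P))) (proj₁ (fresh u))
    shortcut-from P (b ∷ B) cP fresh dP with repeats? b B
    ... | yes (e , eb , eB) = shortcut-close P b B cP fresh dP eb eB
    ... | no ¬rep = shortcut-extend P b B cP fresh dP ¬rep

    shortcut-close : ∀ {c d e} (P : List⁺ A) b B → In c (List⁺.head P) → Fresh (toList P) (b ∷ B) →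
      In d (List⁺.last (P ⁺++ (b ∷ B))) → In e b → Any (In e) B →
      Σ (Shortcut c d (toList (P ⁺++ (b ∷ B)))) (NotRevisited (toList P) ∘ visited ∘ arcs)
    shortcut-close {d = d} {e} P b (y ∷ ys) cP fresh dP eb eB = record
        { arcs     = first ∷ arcs rest
        ; segments = subst (λ xs → Segments xs (map Arc.segment (first ∷ arcs rest)))
                       (cong toList (⁺∷ʳ-⁺++ P b (y ∷ ys))) (cut (P ⁺∷ʳ b) (segments rest))
        ; route    = _ , inj₁ refl ∷ proj₂ (route rest)
        ; sparse   = proj₁ thin
        } , proj₂ thin
      where
      first : Arc
      first = arc (P ⁺∷ʳ b) cP (subst (In e) (sym (last-⁺∷ʳ P b)) eb)
      seek : Σ (Shortcut e d (y ∷ ys)) λ r → count e (visited (arcs r)) ≤ 1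
      seek = shortcut-seek y ys eB
               (subst (In d) (trans (last-++ (List⁺.head P) (List⁺.tail P) b (y ∷ ys)) (last-∷ b y ys)) dP)
      rest = proj₁ seek
      thin = closing-sparse {P = toList P} {B = y ∷ ys} fresh eb (Segments⇒⊑ (segments rest))
               (proj₂ seek) (sparse rest)

    shortcut-extend : ∀ {c d} (P : List⁺ A) b B → In c (List⁺.head P) → Fresh (toList P) (b ∷ B) →
      In d (List⁺.last (P ⁺++ (b ∷ B))) → ¬ Repeats b B →
      Σ (Shortcut c d (toList (P ⁺++ (b ∷ B)))) (NotRevisited (toList P) ∘ visited ∘ arcs)
    shortcut-extend {c} {d} P b B cP fresh dP ¬rep =
      subst (λ Q → Σ (Shortcut c d (toList Q)) (NotRevisited (toList P) ∘ visited ∘ arcs)) (⁺∷ʳ-⁺++ P b B)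
        (proj₁ extended , λ u once → proj₂ extended u (fresh-∷ʳ-once {toList P} fresh once))
      where
      extended = shortcut-from (P ⁺∷ʳ b) B cP (fresh-∷ʳ {toList P} fresh ¬rep)
                   (subst (In d ∘ List⁺.last) (sym (⁺∷ʳ-⁺++ P b B)) dP)

    shortcut-seek : ∀ {e d} x xs → Any (In e) (x ∷ xs) → In d (List⁺.last (x ∷ xs)) →
      Σ (Shortcut e d (x ∷ xs)) λ r → count e (visited (arcs r)) ≤ 1
    shortcut-seek {e} x xs ex dL with any? (In? e) xs
    shortcut-seek x [] ex dL | yes ()
    shortcut-seek x (y ∷ ys) ex dL | yes eys with shortcut-seek y ys eys (subst (In _) (last-∷ x y ys) dL)
    ... | r , thin =
      record { arcs = arcs r ; segments = skip (segments r) ; route = route r ; sparse = sparse r } , thin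
    shortcut-seek x xs ex dL | no ¬exs = proj₁ start , proj₂ start _ (count-∷-∈ [] ex′)
      where
      ex′ = Any-head ex ¬exs
      start = shortcut-from (x ∷ []) xs ex′ (fresh-[-] ex′ ¬exs) dL

  shortcut : ∀ {c d} (p : List⁺ A) → In c (List⁺.head p) → In d (List⁺.last p) → Shortcut c d (toList p)
  shortcut (x ∷ xs) cx dp = proj₁ (shortcut-seek x xs (here cx) dp)

  visited-++ : ∀ X Y → visited (X ++ Y) ≡ visited X ++ visited Y
  visited-++ X Y = begin
    vertices (map Arc.segment (X ++ Y))           ≡⟨ cong vertices (map-++ Arc.segment X Y) ⟩
    vertices (map Arc.segment X ++ map Arc.segment Y)
                                                  ≡⟨ cong concat (map-++ toList (map Arc.segment X) _) ⟩
    concat (map toList (map Arc.segment X) ++ map toList (map Arc.segment Y))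
                                                  ≡⟨ concat-++ (map toList (map Arc.segment X)) _ ⟨
    visited X ++ visited Y                        ∎
    where open ≡-Reasoning

  Segments-concat-tabulate : ∀ {m} (p : Fin m → List⁺ A) (F : Fin m → List Arc) →
    (∀ e → Segments (toList (p e)) (map Arc.segment (F e))) →
    Segments (vertices (tabulate p)) (map Arc.segment (concat (tabulate F)))
  Segments-concat-tabulate {zero} p F σ = []
  Segments-concat-tabulate {suc m} p F σ =
    subst (Segments _) (sym (map-++ Arc.segment (F zero) (concat (tabulate (F ∘ suc)))))
      (Segments-++ (σ zero) (Segments-concat-tabulate (p ∘ suc) (F ∘ suc) (σ ∘ suc)))

  count-concat-tabulate : ∀ {m} u (F : Fin m → List Arc) → (∀ e → count u (visited (F e)) ≤ 2) →
    count u (visited (concat (tabulate F))) ≤ m * 2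
  count-concat-tabulate {zero} u F bound = z≤n
  count-concat-tabulate {suc m} u F bound = begin
    count u (visited (F zero ++ rest))                  ≡⟨ cong (count u) (visited-++ (F zero) rest) ⟩
    count u (visited (F zero) ++ visited rest)          ≡⟨ count-++ u (visited (F zero)) (visited rest) ⟩
    count u (visited (F zero)) + count u (visited rest)
      ≤⟨ +-mono-≤ (bound zero) (count-concat-tabulate u (F ∘ suc) (bound ∘ suc)) ⟩
    2 + m * 2                                           ∎
    where
    open ≤-Reasoning
    rest = concat (tabulate (F ∘ suc))

  visited-↭ : ∀ {X Y} → X ↭ Y → visited X ↭ visited Y
  visited-↭ p = concat-map-↭ toList (↭.map⁺ Arc.segment p)

module _ {n} {G : Graph n} where

  IsPathSystem⁻ : ∀ {𝒫} → IsPathSystem G 𝒫 → All (Linked (Adj G) ∘ toList) 𝒫 × Unique (V 𝒫)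
  IsPathSystem⁻ (paths , disjoint) =
    All.map proj₁ paths , Unique.concat⁺ (All.map⁺ (All.map proj₂ paths)) (AllPairs.map⁺ disjoint)

  IsPathSystem⁺ : ∀ {𝒫} → All (Linked (Adj G) ∘ toList) 𝒫 → Unique (V 𝒫) → IsPathSystem G 𝒫
  IsPathSystem⁺ linked unique with Unique-concat⁻ unique
  ... | uniques , disjoint = All.zip (linked , All.map⁻ uniques) , AllPairs.map⁻ disjoint

module Classes {n k} (𝒰 : Fin k → Subset n)
                (disjoint : ∀ i j → i ≢ j → Subset.Empty (𝒰 i Subset.∩ 𝒰 j)) where

  ∈-unique : ∀ {i j v} → v Subset.∈ 𝒰 i → v Subset.∈ 𝒰 j → i ≡ j
  ∈-unique {i} {j} vi vj with i ≟ j
  ... | yes i≡j = i≡j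
  ... | no i≢j = ⊥-elim (disjoint i j i≢j (_ , x∈p∩q⁺ (vi , vj)))

  open Shortcutting (λ i v → v Subset.∈ 𝒰 i) (λ i v → v ∈? 𝒰 i) (λ v → Fin.any? λ i → v ∈? 𝒰 i) ∈-unique
    public

  arcs-anchored : ∀ X → Anchored 𝒰 (map Arc.segment X)
  arcs-anchored [] = []
  arcs-anchored (arc _ hi li ∷ X) = ((_ , hi) , (_ , li)) ∷ arcs-anchored X

  arcs-reduced : ∀ X → IsReduced 𝒰 (map Arc.segment X) (map classes X)
  arcs-reduced [] = []
  arcs-reduced (arc _ hi li ∷ X) = (hi , li) ∷ arcs-reduced X

  module Splice {𝒫 : PathSystem n} {E : Multigraph k} (reduced : IsReduced 𝒰 𝒫 E) where

    path : Fin (length E) → List⁺ (Fin n)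
    path = Pointwise-index reduced

    shortcut-at : ∀ e → Shortcut (proj₁ (lookup E e)) (proj₂ (lookup E e)) (toList (path e))
    shortcut-at e = shortcut (path e) (proj₁ (Pointwise-index-R reduced e)) (proj₂ (Pointwise-index-R reduced e))

    pieces : Fin (length E) → List Arc
    pieces = Shortcut.arcs ∘ shortcut-at

    spliced : List Arc
    spliced = concat (tabulate pieces)

    spliced-linked : ∀ {R} → All (Linked R ∘ toList) 𝒫 → All (Linked R ∘ toList ∘ Arc.segment) spliced
    spliced-linked linked = All.concat⁺ (All.tabulate⁺ λ e →
      All.map⁻ (Segments-linked (Shortcut.segments (shortcut-at e)) (All.tabulate⁻ linked′ e)))
      where
      linked′ = subst (All _) (sym (tabulate-Pointwise-index reduced)) linked

    spliced-unique : Unique (V 𝒫) → Unique (visited spliced)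
    spliced-unique unique =
      Unique-resp-⊑ (Segments⇒⊑ (Segments-concat-tabulate path pieces (Shortcut.segments ∘ shortcut-at)))
        (subst (Unique ∘ vertices) (sym (tabulate-Pointwise-index reduced)) unique)

    spliced-sparse : ∀ u → count u (visited spliced) ≤ 2 * length 𝒫
    spliced-sparse u =
      subst (count u (visited spliced) ≤_) (trans (*-comm (length E) 2) (cong (2 *_) (sym (Pointwise-length reduced))))
        (count-concat-tabulate u pieces (λ e → Shortcut.sparse (shortcut-at e) u))

    spliced-tour : EulerTour E → ∃ λ X → X ↭ spliced × EulerTour (map classes X)
    spliced-tour (v , vs , es , walk , es↭ , covers)
      with Trail-substitute pieces (Shortcut.route ∘ shortcut-at) (Walk⇒Trail walk)
    ... | ws , X , trail , vs⊆ws , X↭ =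
      X , ↭-trans X↭ (↭-trans (concat-map-↭ pieces es↭) (↭.↭-reflexive (cong concat (map-tabulate id pieces)))) ,
      v , ws , _ , Trail⇒Walk trail , ↭-refl , vs⊆ws ∘ covers

proposition8p4 : ∀ {n k} (G : Graph n) (𝒰 : Fin k → Subset n) → IsCollection 𝒰 →
    (𝒫 : PathSystem n) → IsPathSystem G 𝒫 → Anchored 𝒰 𝒫 → ReducedHasEulerTour 𝒰 𝒫 →
    Σ (PathSystem n) λ 𝒫′ → IsPathSystem G 𝒫′ × Anchored 𝒰 𝒫′ × ReducedHasEulerTour 𝒰 𝒫′ ×
      (∀ i → countIn (𝒰 i) 𝒫′ ≤ 2 * length 𝒫)
proposition8p4 G 𝒰 (_ , disjoint) 𝒫 system _ (E , reduced , tour) =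
  map Arc.segment X , IsPathSystem⁺ {G = G} linked unique , arcs-anchored X ,
  (map classes X , arcs-reduced X , X-tour) , sparse
  where
  open Classes 𝒰 disjoint
  open Splice reduced
  X = proj₁ (spliced-tour tour)
  X↭ = proj₁ (proj₂ (spliced-tour tour))
  X-tour = proj₂ (proj₂ (spliced-tour tour))
  linked = All.map⁺ (All-resp-↭ (↭-sym X↭) (spliced-linked (proj₁ (IsPathSystem⁻ {G = G} system))))
  unique = Unique-resp-↭ (↭-sym (visited-↭ X↭)) (spliced-unique (proj₂ (IsPathSystem⁻ {G = G} system)))
  sparse : ∀ u → countIn (𝒰 u) (map Arc.segment X) ≤ 2 * length 𝒫
  sparse u =
    subst (_≤ 2 * length 𝒫) (sym (↭-length (filter-↭ (_∈? 𝒰 u) (visited-↭ X↭)))) (spliced-sparse u)
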